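{- Let $f$ be the morphism on $\{\mathtt{0},\ldots,\mathtt{4}\}^*$ with $f(\mathtt{0})=\mathtt{01203}$, $f(\mathtt{1})=\mathtt{0124}$, $f(\mathtt{2})=\mathtt{0120323}$, $f(\mathtt{3})=\mathtt{01240324}$, $f(\mathtt{4})=\mathtt{01240323}$, and $g:\{\mathtt{0},\ldots,\mathtt{4}\}^*\to\{\mathtt{a},\mathtt{b},\mathtt{c},\mathtt{d},\mathtt{e}\}^*$ the morphism with $g(\mathtt{0})=\mathtt{abcdeacd}$, $g(\mathtt{1})=\mathtt{abcdbecd}$, $g(\mathtt{2})=\mathtt{abcdeacdbe}$, $g(\mathtt{3})=\mathtt{abcdbecdeacdbecd}$, $g(\mathtt{4})=\mathtt{abcdbecdeacdbe}$, and let $w_5=g(f^\omega(\mathtt{0}))$. For $d\ge 0$ let $p_{\mathtt{23}}=\mathtt{e}\,g(\mathtt{3}\,f(\mathtt{3})\cdots f^{d-1}(\mathtt{3})\,f^d(\mathtt{3}))$ and $s_{\mathtt{23}}=g(f^{d-1}(\mathtt{01203})\,f^{d-2}(\mathtt{01203})\cdots f(\mathtt{01203})\,\mathtt{01203})\,\mathtt{abcdeacdb}$ (where the product inside $g$ in $s_{\mathtt{23}}$ is empty when $d=0$). Then for every $d\ge 0$, the word $T_{\mathtt{23}}=p_{\mathtt{23}}s_{\mathtt{23}}$ is a conjugate of $g(f^d(\mathtt{23}))$ that is not a factor of $w_5$.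
   Context: $f^\omega(\mathtt{0})$ is the infinite fixed point of $f$ starting with $\mathtt{0}$. A conjugate of a word $xy$ is $yx$. -}

module Defs where

open import Data.Nat using (ℕ; zero; suc; _+_)
open import Data.List using (List; []; _∷_; _++_; concatMap; length; lookup)
open import Data.Fin using (Fin; toℕ)
open import Data.Product using (Σ; ∃; _×_; _,_)
open import Relation.Binary.PropositionalEquality using (_≡_)

data D : Set where
  D0 D1 D2 D3 D4 : D

data L : Set where
  a b c d e : L

fL : D → List D
fL D0 = D0 ∷ D1 ∷ D2 ∷ D0 ∷ D3 ∷ []
fL D1 = D0 ∷ D1 ∷ D2 ∷ D4 ∷ []
fL D2 = D0 ∷ D1 ∷ D2 ∷ D0 ∷ D3 ∷ D2 ∷ D3 ∷ []
fL D3 = D0 ∷ D1 ∷ D2 ∷ D4 ∷ D0 ∷ D3 ∷ D2 ∷ D4 ∷ []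
fL D4 = D0 ∷ D1 ∷ D2 ∷ D4 ∷ D0 ∷ D3 ∷ D2 ∷ D3 ∷ []

f : List D → List D
f = concatMap fL

gL : D → List L
gL D0 = a ∷ b ∷ c ∷ d ∷ e ∷ a ∷ c ∷ d ∷ []
gL D1 = a ∷ b ∷ c ∷ d ∷ b ∷ e ∷ c ∷ d ∷ []
gL D2 = a ∷ b ∷ c ∷ d ∷ e ∷ a ∷ c ∷ d ∷ b ∷ e ∷ []
gL D3 = a ∷ b ∷ c ∷ d ∷ b ∷ e ∷ c ∷ d ∷ e ∷ a ∷ c ∷ d ∷ b ∷ e ∷ c ∷ d ∷ []
gL D4 = a ∷ b ∷ c ∷ d ∷ b ∷ e ∷ c ∷ d ∷ e ∷ a ∷ c ∷ d ∷ b ∷ e ∷ []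

g : List D → List L
g = concatMap gL

f^ : ℕ → List D → List D
f^ zero    w = w
f^ (suc n) w = f (f^ n w)

-- total lookup with a default letter (only used at in-range positions)
nth : {A : Set} → A → List A → ℕ → A
nth x₀ []       _       = x₀
nth x₀ (x ∷ xs) zero    = x
nth x₀ (x ∷ xs) (suc i) = nth x₀ xs i

-- Infinite words are functions ℕ → alphabet.
-- f^ω(0): since f(0) begins with 0, f^n(0) is a prefix of f^(n+1)(0), and
-- |f^(i+1)(0)| > i, so position i of f^ω(0) is position i of f^(i+1)(0).
fω0 : ℕ → D
fω0 i = nth D0 (f^ (suc i) (D0 ∷ [])) i

-- w₅ = g(f^ω(0)); g(f^n(0)) is a prefix of g(f^ω(0)) and |g(f^(i+1)(0))| > i,
-- so position i of w₅ is position i of g(f^(i+1)(0)).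
w5 : ℕ → L
w5 i = nth a (g (f^ (suc i) (D0 ∷ []))) i

IsFactorOf : {A : Set} → List A → (ℕ → A) → Set
IsFactorOf u w = ∃ λ i → (j : Fin (length u)) → w (i + toℕ j) ≡ lookup u j

IsConjugateOf : {A : Set} → List A → List A → Set
IsConjugateOf u v = ∃ λ x → ∃ λ y → (v ≡ x ++ y) × (u ≡ y ++ x)

up3 : ℕ → List D
up3 zero    = D3 ∷ []
up3 (suc n) = up3 n ++ f^ (suc n) (D3 ∷ [])

w01203 : List D
w01203 = D0 ∷ D1 ∷ D2 ∷ D0 ∷ D3 ∷ []

-- f^(d-1)(01203) ... f(01203) 01203   (empty when d = 0)
down : ℕ → List D
down zero    = []
down (suc n) = f^ n w01203 ++ down n

p23 : ℕ → List L
p23 n = e ∷ g (up3 n)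

s23 : ℕ → List L
s23 n = g (down n) ++ (a ∷ b ∷ c ∷ d ∷ e ∷ a ∷ c ∷ d ∷ b ∷ [])

T23 : ℕ → List L
T23 n = p23 n ++ s23 n

-- f and g are marked morphisms: every letter image begins with a two-letter marker
-- (01 for f, ab for g) that occurs nowhere else inside an image, and distinct letters
-- have distinct images. Hence an image word can be cut into blocks at the markers only,
-- and an occurrence of h(Q) in h(W) that starts and ends at block boundaries
-- desubstitutes to an occurrence of Q in W.
--
-- With core23 n = 3 f(3) ⋯ fⁿ(3) fⁿ⁻¹(01203) ⋯ 01203 we have
-- fⁿ(23) = fⁿ⁻¹(01203) ⋯ 01203 · 2 · 3 f(3) ⋯ fⁿ(3), giving the conjugacy, and
-- T23 = e · g(core23 n) · abcdeacdb. Only 2 and 4 have g-images ending in e, and only 2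
-- has a g-image beginning with abcdeacdb, so an occurrence of T23 in g(fⁿ⁺¹(V))
-- desubstitutes to an occurrence of y · core23 n · 2 in fⁿ⁺¹(V) with y ∈ {2, 4}.
-- Since core23 (n+1) = 3 · f(core23 n) · 01203, and only 2 and 4 have f-images ending
-- in y3 while only 2 has one beginning with 012032, this descends level by level to an
-- occurrence of y32 in some f(V). That is impossible: 32 cannot straddle a block
-- boundary, and inside a block it is always preceded by 0. Finally, every factor of
-- w₅ = g(f^ω(0)) occurs in g(fⁿ⁺¹(f^K(0))) for K large.

module Submission where

open import Defs
open import Data.Empty using (⊥-elim)
open import Data.Fin using (Fin; #_; toℕ) renaming (zero to fzero; suc to fsuc)
import Data.Fin.Properties as Fin
open import Data.List using (List; []; _∷_; _++_; concatMap; length; lookup)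
open import Data.List.Properties
  using (++-assoc; ++-identityʳ; ++-cancelˡ; ++-conicalˡ; ++-conicalʳ; concatMap-++; length-++;
         ∷-injective; ∷-injectiveˡ; ∷-injectiveʳ; ≡-dec)
open import Data.List.Relation.Unary.All using (All; []; _∷_)
open import Data.List.Relation.Binary.Pointwise using (≡⇒Pointwise-≡)
open import Data.List.Relation.Binary.Infix.Heterogeneous using (Infix; MkView; fromView)
open import Data.List.Relation.Binary.Infix.Heterogeneous.Properties using (infix?)
open import Data.List.Relation.Binary.Suffix.Heterogeneous as Suffix using (Suffix)
open import Data.List.Relation.Binary.Suffix.Heterogeneous.Properties using (suffix?)
open import Data.Nat using (ℕ; zero; suc; _+_; _≤_; _<_; z≤n; s≤s)
open import Data.Nat.Properties
  using (≤-trans; <-trans; <-≤-trans; <⇒≤; n<1+n; m≤m+n; m≤n+m; +-mono-≤; +-monoʳ-<; +-suc;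
         m≤n⇒∃[o]m+o≡n)
open import Data.Product using (∃; ∃₂; _×_; _,_)
open import Data.Sum using (_⊎_; inj₁; inj₂)
import Data.Vec as Vec
open import Function.Bundles using (mk↣)
open import Function.Consequences.Propositional using (inverseʳ⇒injective; strictlyInverseʳ⇒inverseʳ)
open import Function.Definitions using (Injective)
open import Relation.Binary.Definitions using (DecidableEquality)
open import Relation.Binary.PropositionalEquality
open import Relation.Nullary using (¬_; contradiction)
open import Relation.Nullary.Decidable using (False; toWitnessFalse; via-injection)

private
  variable
    X : Set

++-levi : ∀ (xs ys zs ws : List X) → xs ++ ys ≡ zs ++ ws →
  (∃ λ m → zs ≡ xs ++ m × ys ≡ m ++ ws) ⊎
  (∃₂ λ k m → xs ≡ zs ++ k ∷ m × ws ≡ k ∷ m ++ ys)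
++-levi []       ys zs       ws eq = inj₁ (zs , refl , eq)
++-levi (x ∷ xs) ys []       ws eq = inj₂ (x , xs , refl , sym eq)
++-levi (x ∷ xs) ys (z ∷ zs) ws eq with refl , eq′ ← ∷-injective eq
  with ++-levi xs ys zs ws eq′
... | inj₁ (m , zs≡ , ys≡)       = inj₁ (m , cong (x ∷_) zs≡ , ys≡)
... | inj₂ (k , m , xs≡ , ws≡)   = inj₂ (k , m , cong (x ∷_) xs≡ , ws≡)

infix-of : ∀ (p u s : List X) → Infix _≡_ u (p ++ u ++ s)
infix-of p u s = fromView (MkView p (≡⇒Pointwise-≡ refl) s)

suffix-of : ∀ (p u : List X) → Suffix _≡_ u (p ++ u)
suffix-of p u = Suffix.fromView (p Suffix.++ ≡⇒Pointwise-≡ refl)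

left-inverse⇒injective : ∀ {Y : Set} (f : X → Y) (f⁻¹ : Y → X) →
  (∀ x → f⁻¹ (f x) ≡ x) → Injective _≡_ _≡_ f
left-inverse⇒injective f f⁻¹ inv = inverseʳ⇒injective f (strictlyInverseʳ⇒inverseʳ {f⁻¹ = f⁻¹} f inv)

module MarkedMorphism {A B : Set} (hL : A → List B) (m₁ m₂ : B) (m₁≢m₂ : m₁ ≢ m₂)
  (hL-injective : Injective _≡_ _≡_ hL)
  (hL-marked : ∀ x → ∃ λ z → hL x ≡ m₁ ∷ m₂ ∷ z × ¬ Infix _≡_ (m₁ ∷ m₂ ∷ []) z)
  where

  h : List A → List B
  h = concatMap hL

  -- What can follow a block boundary in an image word: nothing, or the marker.
  data Marked : List B → Set where
    end    : Marked []
    marker : ∀ r → Marked (m₁ ∷ m₂ ∷ r)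

  marked-h++ : ∀ w {t} → Marked t → Marked (h w ++ t)
  marked-h++ []      mt = mt
  marked-h++ (x ∷ w) {t} _ with hL x | hL-marked x
  ... | _ | z , refl , _ = marker _

  marked-h : ∀ w → Marked (h w)
  marked-h w = subst Marked (++-identityʳ (h w)) (marked-h++ w end)

  h≡[]⇒≡[] : ∀ w → h w ≡ [] → w ≡ []
  h≡[]⇒≡[] []      _  = refl
  h≡[]⇒≡[] (x ∷ w) eq with hL x | hL-marked x
  h≡[]⇒≡[] (x ∷ w) () | _ | _ , refl , _

  length-h : ∀ w → length w + length w ≤ length (h w)
  length-h []      = z≤n
  length-h (x ∷ w) with hL x | hL-marked x
  ... | _ | z , refl , _ rewrite +-suc (length w) (length w) | length-++ z {h w} =
    s≤s (s≤s (≤-trans (length-h w) (m≤n+m _ (length z))))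

  marked-head : ∀ {s v l} → Marked s → s ≡ v ∷ l → v ≡ m₁
  marked-head end        ()
  marked-head (marker r) eq = sym (∷-injectiveˡ eq)

  marked-continuation : ∀ k m {s t} → Marked s → Marked t → t ≡ k ∷ m ++ s →
    ∃ λ m′ → k ∷ m ≡ m₁ ∷ m₂ ∷ m′
  marked-continuation k m       ms end        ()
  marked-continuation k []      ms (marker r) eq =
    ⊥-elim (m₁≢m₂ (sym (marked-head ms (sym (∷-injectiveʳ eq)))))
  marked-continuation k (q ∷ m) ms (marker r) eq =
    m , cong₂ _∷_ (sym (∷-injectiveˡ eq)) (cong (_∷ m) (sym (∷-injectiveˡ (∷-injectiveʳ eq))))

  marker-only-at-start : ∀ x y p r → hL x ≢ y ∷ p ++ m₁ ∷ m₂ ∷ r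
  marker-only-at-start x y p r eq with hL-marked x
  ... | z , hLx , free with p | ∷-injectiveʳ (trans (sym hLx) eq)
  ... | []    | eq′ = m₁≢m₂ (sym (∷-injectiveˡ eq′))
  ... | _ ∷ p | eq′ = free (subst (Infix _≡_ _) (sym (∷-injectiveʳ eq′)) (infix-of p _ r))

  image-no-inner-boundary : ∀ x y p k m {s} → Marked s → Marked (k ∷ m ++ s) →
    hL x ≢ y ∷ p ++ k ∷ m
  image-no-inner-boundary x y p k m ms mkms eq
    with m′ , km≡ ← marked-continuation k m ms mkms refl
    = marker-only-at-start x y p m′ (trans eq (cong (λ w → y ∷ p ++ w) km≡))

  image-not-extended : ∀ x u k m {s} → Marked s → Marked (k ∷ m ++ s) → hL u ≢ hL x ++ k ∷ m
  image-not-extended x u k m ms mkms eq with z , hLx , _ ← hL-marked x =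
    image-no-inner-boundary u m₁ (m₂ ∷ z) k m ms mkms (trans eq (cong (_++ k ∷ m) hLx))

  leading-letter-unique : ∀ x u {s₁ s₂} → Marked s₁ → Marked s₂ → hL x ++ s₁ ≡ hL u ++ s₂ → x ≡ u
  leading-letter-unique x u ms₁ ms₂ eq with ++-levi (hL x) _ (hL u) _ eq
  ... | inj₁ ([]    , hLu≡ , _)   = sym (hL-injective (trans hLu≡ (++-identityʳ (hL x))))
  ... | inj₁ (k ∷ m , hLu≡ , s₁≡) = ⊥-elim (image-not-extended x u k m ms₂ (subst Marked s₁≡ ms₁) hLu≡)
  ... | inj₂ (k , m , hLx≡ , s₂≡) = ⊥-elim (image-not-extended u x k m ms₁ (subst Marked s₂≡ ms₂) hLx≡)

  split-at-marked : ∀ v p {t} → Marked t → h v ≡ p ++ t →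
    ∃₂ λ v₁ v₂ → v ≡ v₁ ++ v₂ × h v₁ ≡ p × h v₂ ≡ t
  split-at-marked v       []      _  eq = [] , v , refl , refl , eq
  split-at-marked []      (y ∷ p) _  ()
  split-at-marked (x ∷ v) (y ∷ p) mt eq with ++-levi (hL x) (h v) (y ∷ p) _ eq
  ... | inj₁ (m , p≡ , hv≡) with v₁ , v₂ , v≡ , hv₁ , hv₂ ← split-at-marked v m mt hv≡ =
    x ∷ v₁ , v₂ , cong (x ∷_) v≡ , trans (cong (hL x ++_) hv₁) (sym p≡) , hv₂
  ... | inj₂ (k , m , hLx≡ , t≡) =
    ⊥-elim (image-no-inner-boundary x y p k m (marked-h v) (subst Marked t≡ mt) hLx≡)

  cancel-prefix : ∀ U v {t} → Marked t → h v ≡ h U ++ t → ∃ λ v′ → v ≡ U ++ v′ × h v′ ≡ t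
  cancel-prefix []      v       _  eq = v , refl , eq
  cancel-prefix (u ∷ U) []      _  eq with () ← h≡[]⇒≡[] (u ∷ U) (++-conicalˡ _ _ (sym eq))
  cancel-prefix (u ∷ U) (x ∷ v) {t} mt eq
    with eq′ ← trans eq (++-assoc (hL u) (h U) t)
    with refl ← leading-letter-unique x u (marked-h v) (marked-h++ U mt) eq′
    with v′ , v≡ , hv′ ← cancel-prefix U v mt (++-cancelˡ (hL x) _ _ eq′)
    = v′ , cong (x ∷_) v≡ , hv′

  desubstitute : ∀ W p Q {t} → Marked t → h W ≡ p ++ h Q ++ t →
    ∃₂ λ W₁ W₃ → W ≡ W₁ ++ Q ++ W₃ × h W₁ ≡ p × h W₃ ≡ t
  desubstitute W p Q mt eq
    with W₁ , W₂ , W≡ , hW₁ , hW₂ ← split-at-marked W p (marked-h++ Q mt) eq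
    with W₃ , W₂≡ , hW₃ ← cancel-prefix Q W₂ mt hW₂
    = W₁ , W₃ , trans W≡ (cong (W₁ ++_) W₂≡) , hW₁ , hW₃

  marker-free-prefix : ∀ u m r {s} → All (_≢ m₁) u → Marked s → u ++ r ≡ m ++ s →
    ∃ λ p → m ≡ u ++ p × r ≡ p ++ s
  marker-free-prefix []      m       r _           _  eq = m , refl , eq
  marker-free-prefix (v ∷ u) []      r (v≢m₁ ∷ _)  ms eq = ⊥-elim (v≢m₁ (marked-head ms (sym eq)))
  marker-free-prefix (v ∷ u) (w ∷ m) r (_ ∷ free) ms eq
    with refl , eq′ ← ∷-injective eq
    with p , m≡ , r≡ ← marker-free-prefix u m r free ms eq′
    = p , cong (v ∷_) m≡ , r≡

  occurrence-within-image : ∀ W p y u r → All (_≢ m₁) u → h W ≡ p ++ y ∷ u ++ r →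
    ∃ λ W₁ → ∃ λ x → ∃ λ W₂ → ∃₂ λ p₁ p₃ →
      W ≡ W₁ ++ x ∷ W₂ × hL x ≡ p₁ ++ y ∷ u ++ p₃ × r ≡ p₃ ++ h W₂
  occurrence-within-image []      []      y u r _    ()
  occurrence-within-image []      (_ ∷ _) y u r _    ()
  occurrence-within-image (x ∷ W) p       y u r free eq with ++-levi (hL x) (h W) p _ eq
  ... | inj₁ (m , p≡ , hW≡)
    with W₁ , x′ , W₂ , p₁ , p₃ , W≡ , hLx′ , r≡ ← occurrence-within-image W m y u r free hW≡
    = x ∷ W₁ , x′ , W₂ , p₁ , p₃ , cong (x ∷_) W≡ , hLx′ , r≡
  ... | inj₂ (k , m , hLx≡ , yur≡)
    with refl , ur≡ ← ∷-injective yur≡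
    with p₃ , m≡ , r≡ ← marker-free-prefix u m r free (marked-h W) ur≡
    = [] , x , W , p , p₃ , refl , trans hLx≡ (cong (λ w → p ++ y ∷ w) m≡) , r≡

  factor-within-image : ∀ W p y u r → All (_≢ m₁) u → h W ≡ p ++ y ∷ u ++ r →
    ∃ λ x → Infix _≡_ (y ∷ u) (hL x)
  factor-within-image W p y u r free eq
    with _ , x , _ , p₁ , p₃ , _ , hLx , _ ← occurrence-within-image W p y u r free eq
    = x , subst (Infix _≡_ (y ∷ u)) (sym hLx) (infix-of p₁ (y ∷ u) p₃)

  last-image : ∀ W p y u → All (_≢ m₁) u → h W ≡ p ++ y ∷ u →
    ∃₂ λ W₁ x → W ≡ W₁ ++ x ∷ [] × Suffix _≡_ (y ∷ u) (hL x)
  last-image W p y u free eq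
    with W₁ , x , W₂ , p₁ , p₃ , W≡ , hLx , []≡ ←
           occurrence-within-image W p y u [] free (trans eq (cong (λ w → p ++ y ∷ w) (sym (++-identityʳ u))))
    with refl ← ++-conicalˡ p₃ _ (sym []≡)
    with refl ← h≡[]⇒≡[] W₂ (++-conicalʳ [] _ (sym []≡))
    = W₁ , x , W≡ ,
      subst (Suffix _≡_ (y ∷ u)) (sym (trans hLx (cong (λ w → p₁ ++ y ∷ w) (++-identityʳ u))))
        (suffix-of p₁ (y ∷ u))

  desubstitute-around : ∀ W p y u Q {t} → All (_≢ m₁) u → Marked t →
    h W ≡ p ++ y ∷ u ++ h Q ++ t →
    ∃ λ W₁ → ∃ λ z → ∃ λ W₃ → W ≡ W₁ ++ z ∷ Q ++ W₃ × Suffix _≡_ (y ∷ u) (hL z) × h W₃ ≡ t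
  desubstitute-around W p y u Q free mt eq
    with W₁ , W₃ , W≡ , hW₁ , hW₃ ← desubstitute W (p ++ y ∷ u) Q mt (trans eq (sym (++-assoc p (y ∷ u) _)))
    with W₁′ , z , refl , suffix ← last-image W₁ p y u free hW₁
    = W₁′ , z , W₃ , trans W≡ (++-assoc W₁′ (z ∷ []) _) , suffix , hW₃

indexᴸ : L → Fin 5
indexᴸ a = # 0
indexᴸ b = # 1
indexᴸ c = # 2
indexᴸ d = # 3
indexᴸ e = # 4

letterᴸ : Fin 5 → L
letterᴸ = Vec.lookup (a Vec.∷ b Vec.∷ c Vec.∷ d Vec.∷ e Vec.∷ Vec.[])

letter-indexᴸ : ∀ x → letterᴸ (indexᴸ x) ≡ x
letter-indexᴸ a = refl
letter-indexᴸ b = refl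
letter-indexᴸ c = refl
letter-indexᴸ d = refl
letter-indexᴸ e = refl

_≟ᴸ_ : DecidableEquality L
_≟ᴸ_ = via-injection (mk↣ (left-inverse⇒injective indexᴸ letterᴸ letter-indexᴸ)) Fin._≟_

ungL : List L → D
ungL (a ∷ b ∷ c ∷ d ∷ e ∷ a ∷ c ∷ d ∷ []) = D0
ungL (a ∷ b ∷ c ∷ d ∷ b ∷ e ∷ c ∷ d ∷ []) = D1
ungL (a ∷ b ∷ c ∷ d ∷ e ∷ a ∷ c ∷ d ∷ b ∷ e ∷ []) = D2
ungL (a ∷ b ∷ c ∷ d ∷ b ∷ e ∷ c ∷ d ∷ e ∷ a ∷ c ∷ d ∷ b ∷ e ∷ c ∷ d ∷ []) = D3
ungL _ = D4

ungL-gL : ∀ x → ungL (gL x) ≡ x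
ungL-gL D0 = refl
ungL-gL D1 = refl
ungL-gL D2 = refl
ungL-gL D3 = refl
ungL-gL D4 = refl

gL-injective : Injective _≡_ _≡_ gL
gL-injective = left-inverse⇒injective gL ungL ungL-gL

_≟ᴰ_ : DecidableEquality D
_≟ᴰ_ = via-injection (mk↣ gL-injective) (≡-dec _≟ᴸ_)

¬Infixᴰ : ∀ {u w : List D} → False (infix? _≟ᴰ_ u w) → ¬ Infix _≡_ u w
¬Infixᴰ = toWitnessFalse

¬Infixᴸ : ∀ {u w : List L} → False (infix? _≟ᴸ_ u w) → ¬ Infix _≡_ u w
¬Infixᴸ = toWitnessFalse

¬Suffixᴰ : ∀ {u w : List D} → False (suffix? _≟ᴰ_ u w) → ¬ Suffix _≡_ u w
¬Suffixᴰ = toWitnessFalse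

¬Suffixᴸ : ∀ {u w : List L} → False (suffix? _≟ᴸ_ u w) → ¬ Suffix _≡_ u w
¬Suffixᴸ = toWitnessFalse

unfL : List D → D
unfL (D0 ∷ D1 ∷ D2 ∷ D0 ∷ D3 ∷ []) = D0
unfL (D0 ∷ D1 ∷ D2 ∷ D4 ∷ []) = D1
unfL (D0 ∷ D1 ∷ D2 ∷ D0 ∷ D3 ∷ D2 ∷ D3 ∷ []) = D2
unfL (D0 ∷ D1 ∷ D2 ∷ D4 ∷ D0 ∷ D3 ∷ D2 ∷ D4 ∷ []) = D3
unfL _ = D4

unfL-fL : ∀ x → unfL (fL x) ≡ x
unfL-fL D0 = refl
unfL-fL D1 = refl
unfL-fL D2 = refl
unfL-fL D3 = refl
unfL-fL D4 = refl

fL-injective : Injective _≡_ _≡_ fL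
fL-injective = left-inverse⇒injective fL unfL unfL-fL

fL-marked : ∀ x → ∃ λ z → fL x ≡ D0 ∷ D1 ∷ z × ¬ Infix _≡_ (D0 ∷ D1 ∷ []) z
fL-marked D0 = _ , refl , ¬Infixᴰ _
fL-marked D1 = _ , refl , ¬Infixᴰ _
fL-marked D2 = _ , refl , ¬Infixᴰ _
fL-marked D3 = _ , refl , ¬Infixᴰ _
fL-marked D4 = _ , refl , ¬Infixᴰ _

gL-marked : ∀ x → ∃ λ z → gL x ≡ a ∷ b ∷ z × ¬ Infix _≡_ (a ∷ b ∷ []) z
gL-marked D0 = _ , refl , ¬Infixᴸ _
gL-marked D1 = _ , refl , ¬Infixᴸ _
gL-marked D2 = _ , refl , ¬Infixᴸ _
gL-marked D3 = _ , refl , ¬Infixᴸ _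
gL-marked D4 = _ , refl , ¬Infixᴸ _

module F = MarkedMorphism fL D0 D1 (λ ()) fL-injective fL-marked
module G = MarkedMorphism gL a b (λ ()) gL-injective gL-marked

data Is2or4 : D → Set where
  is2 : Is2or4 D2
  is4 : Is2or4 D4

fL-ending-y3 : ∀ x {y} → Is2or4 y → Suffix _≡_ (y ∷ D3 ∷ []) (fL x) → Is2or4 x
fL-ending-y3 D0 is2 s = contradiction s (¬Suffixᴰ _)
fL-ending-y3 D0 is4 s = contradiction s (¬Suffixᴰ _)
fL-ending-y3 D1 is2 s = contradiction s (¬Suffixᴰ _)
fL-ending-y3 D1 is4 s = contradiction s (¬Suffixᴰ _)
fL-ending-y3 D2 _   _ = is2
fL-ending-y3 D3 is2 s = contradiction s (¬Suffixᴰ _)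
fL-ending-y3 D3 is4 s = contradiction s (¬Suffixᴰ _)
fL-ending-y3 D4 _   _ = is4

gL-ending-e : ∀ x → Suffix _≡_ (e ∷ []) (gL x) → Is2or4 x
gL-ending-e D0 s = contradiction s (¬Suffixᴸ _)
gL-ending-e D1 s = contradiction s (¬Suffixᴸ _)
gL-ending-e D2 _ = is2
gL-ending-e D3 s = contradiction s (¬Suffixᴸ _)
gL-ending-e D4 _ = is4

fL-avoids-y32 : ∀ x {y} → Is2or4 y → ¬ Infix _≡_ (y ∷ D3 ∷ D2 ∷ []) (fL x)
fL-avoids-y32 D0 is2 = ¬Infixᴰ _
fL-avoids-y32 D0 is4 = ¬Infixᴰ _
fL-avoids-y32 D1 is2 = ¬Infixᴰ _
fL-avoids-y32 D1 is4 = ¬Infixᴰ _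
fL-avoids-y32 D2 is2 = ¬Infixᴰ _
fL-avoids-y32 D2 is4 = ¬Infixᴰ _
fL-avoids-y32 D3 is2 = ¬Infixᴰ _
fL-avoids-y32 D3 is4 = ¬Infixᴰ _
fL-avoids-y32 D4 is2 = ¬Infixᴰ _
fL-avoids-y32 D4 is4 = ¬Infixᴰ _

fL-starting-012032 : ∀ x {t} suf → F.Marked t →
  fL x ++ t ≡ D0 ∷ D1 ∷ D2 ∷ D0 ∷ D3 ∷ D2 ∷ suf → x ≡ D2
fL-starting-012032 D0 suf F.end        ()
fL-starting-012032 D0 suf (F.marker _) ()
fL-starting-012032 D1 suf _            ()
fL-starting-012032 D2 suf _            _ = refl
fL-starting-012032 D3 suf _            ()
fL-starting-012032 D4 suf _            ()

f-starting-012032 : ∀ W suf → f W ≡ D0 ∷ D1 ∷ D2 ∷ D0 ∷ D3 ∷ D2 ∷ suf → ∃ λ W′ → W ≡ D2 ∷ W′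
f-starting-012032 []      suf ()
f-starting-012032 (x ∷ W) suf eq with refl ← fL-starting-012032 x suf (F.marked-h W) eq = W , refl

gL-starting-abcdeacdb : ∀ x {t} S → G.Marked t →
  gL x ++ t ≡ a ∷ b ∷ c ∷ d ∷ e ∷ a ∷ c ∷ d ∷ b ∷ S → x ≡ D2
gL-starting-abcdeacdb D0 S G.end        ()
gL-starting-abcdeacdb D0 S (G.marker _) ()
gL-starting-abcdeacdb D1 S _            ()
gL-starting-abcdeacdb D2 S _            _ = refl
gL-starting-abcdeacdb D3 S _            ()
gL-starting-abcdeacdb D4 S _            ()

g-starting-abcdeacdb : ∀ W S → g W ≡ a ∷ b ∷ c ∷ d ∷ e ∷ a ∷ c ∷ d ∷ b ∷ S → ∃ λ W′ → W ≡ D2 ∷ W′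
g-starting-abcdeacdb []      S ()
g-starting-abcdeacdb (x ∷ W) S eq with refl ← gL-starting-abcdeacdb x S (G.marked-h W) eq = W , refl

f^-++ : ∀ k u v → f^ k (u ++ v) ≡ f^ k u ++ f^ k v
f^-++ zero    u v = refl
f^-++ (suc k) u v = trans (cong f (f^-++ k u v)) (concatMap-++ fL (f^ k u) (f^ k v))

f^-+ : ∀ m k w → f^ (m + k) w ≡ f^ m (f^ k w)
f^-+ zero    k w = refl
f^-+ (suc m) k w = cong f (f^-+ m k w)

f^-starts-with-0 : ∀ k → ∃ λ r → f^ k (D0 ∷ []) ≡ D0 ∷ r
f^-starts-with-0 zero    = [] , refl
f^-starts-with-0 (suc k) with r , eq ← f^-starts-with-0 k = _ , cong f eq

f^-prefix : ∀ {k N} → k ≤ N → ∃ λ r → f^ N (D0 ∷ []) ≡ f^ k (D0 ∷ []) ++ r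
f^-prefix {k} k≤N with o , refl ← m≤n⇒∃[o]m+o≡n k≤N with r , eq ← f^-starts-with-0 o =
  f^ k r , (begin
    f^ (k + o) (D0 ∷ [])      ≡⟨ f^-+ k o _ ⟩
    f^ k (f^ o (D0 ∷ []))     ≡⟨ cong (f^ k) eq ⟩
    f^ k (D0 ∷ r)             ≡⟨ f^-++ k (D0 ∷ []) r ⟩
    f^ k (D0 ∷ []) ++ f^ k r  ∎)
  where open ≡-Reasoning

length-f^ : ∀ k → k < length (f^ k (D0 ∷ []))
length-f^ zero    = s≤s z≤n
length-f^ (suc k) = ≤-trans (s≤s (m≤n+m (suc k) k))
  (≤-trans (+-mono-≤ (length-f^ k) (length-f^ k)) (F.length-h (f^ k (D0 ∷ []))))

length-g : ∀ w → length w ≤ length (g w)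
length-g w = ≤-trans (m≤m+n _ _) (G.length-h w)

up3-suc : ∀ n → up3 (suc n) ≡ D3 ∷ f (up3 n)
up3-suc zero    = refl
up3-suc (suc n) = trans (cong (_++ f^ (suc (suc n)) (D3 ∷ [])) (up3-suc n))
  (cong (D3 ∷_) (sym (concatMap-++ fL (up3 n) (f^ (suc n) (D3 ∷ [])))))

down-suc : ∀ n → down (suc n) ≡ f (down n) ++ w01203
down-suc zero    = refl
down-suc (suc n) = trans (cong (f^ (suc n) w01203 ++_) (down-suc n))
  (trans (sym (++-assoc (f (f^ n w01203)) (f (down n)) w01203))
    (cong (_++ w01203) (sym (concatMap-++ fL (f^ n w01203) (down n)))))

f^-23 : ∀ n → f^ n (D2 ∷ D3 ∷ []) ≡ down n ++ D2 ∷ up3 n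
f^-23 zero    = refl
f^-23 (suc n) = begin
  f (f^ n (D2 ∷ D3 ∷ []))                          ≡⟨ cong f (f^-23 n) ⟩
  f (down n ++ D2 ∷ up3 n)                          ≡⟨ concatMap-++ fL (down n) (D2 ∷ up3 n) ⟩
  f (down n) ++ w01203 ++ D2 ∷ D3 ∷ f (up3 n)       ≡⟨ sym (++-assoc (f (down n)) w01203 _) ⟩
  (f (down n) ++ w01203) ++ D2 ∷ D3 ∷ f (up3 n)     ≡⟨ cong₂ (λ u v → u ++ D2 ∷ v) (sym (down-suc n)) (sym (up3-suc n)) ⟩
  down (suc n) ++ D2 ∷ up3 (suc n)                  ∎
  where open ≡-Reasoning

T23-conjugate : ∀ n → IsConjugateOf (T23 n) (g (f^ n (D2 ∷ D3 ∷ [])))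
T23-conjugate n = s23 n , p23 n , g-f^-23 , refl
  where
  g-f^-23 : g (f^ n (D2 ∷ D3 ∷ [])) ≡ s23 n ++ p23 n
  g-f^-23 = trans (cong g (f^-23 n))
    (trans (concatMap-++ gL (down n) (D2 ∷ up3 n))
      (sym (++-assoc (g (down n)) (a ∷ b ∷ c ∷ d ∷ e ∷ a ∷ c ∷ d ∷ b ∷ []) (p23 n))))

core23 : ℕ → List D
core23 n = up3 n ++ down n

core23-suc : ∀ n s → core23 (suc n) ++ s ≡ D3 ∷ f (core23 n) ++ w01203 ++ s
core23-suc n s = begin
  (up3 (suc n) ++ down (suc n)) ++ s               ≡⟨ cong₂ (λ u v → (u ++ v) ++ s) (up3-suc n) (down-suc n) ⟩
  D3 ∷ (f (up3 n) ++ f (down n) ++ w01203) ++ s    ≡⟨ cong (λ w → D3 ∷ w ++ s) (sym (++-assoc (f (up3 n)) (f (down n)) w01203)) ⟩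
  D3 ∷ ((f (up3 n) ++ f (down n)) ++ w01203) ++ s  ≡⟨ cong (λ w → D3 ∷ (w ++ w01203) ++ s) (sym (concatMap-++ fL (up3 n) (down n))) ⟩
  D3 ∷ (f (core23 n) ++ w01203) ++ s               ≡⟨ cong (D3 ∷_) (++-assoc (f (core23 n)) w01203 s) ⟩
  D3 ∷ f (core23 n) ++ w01203 ++ s                 ∎
  where open ≡-Reasoning

T23-unfold : ∀ n S → T23 n ++ S ≡ e ∷ g (core23 n) ++ a ∷ b ∷ c ∷ d ∷ e ∷ a ∷ c ∷ d ∷ b ∷ S
T23-unfold n S = begin
  e ∷ (g (up3 n) ++ g (down n) ++ K) ++ S    ≡⟨ cong (e ∷_) (++-assoc (g (up3 n)) _ S) ⟩
  e ∷ g (up3 n) ++ (g (down n) ++ K) ++ S    ≡⟨ cong (λ w → e ∷ g (up3 n) ++ w) (++-assoc (g (down n)) K S) ⟩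
  e ∷ g (up3 n) ++ g (down n) ++ K ++ S      ≡⟨ cong (e ∷_) (sym (++-assoc (g (up3 n)) (g (down n)) _)) ⟩
  e ∷ (g (up3 n) ++ g (down n)) ++ K ++ S    ≡⟨ cong (λ w → e ∷ w ++ K ++ S) (sym (concatMap-++ gL (up3 n) (down n))) ⟩
  e ∷ g (core23 n) ++ K ++ S                 ∎
  where
  open ≡-Reasoning
  K : List L
  K = a ∷ b ∷ c ∷ d ∷ e ∷ a ∷ c ∷ d ∷ b ∷ []

f^-avoids-y·core23·2 : ∀ n {y} → Is2or4 y → ∀ V pre suf → f^ (suc n) V ≢ pre ++ y ∷ core23 n ++ D2 ∷ suf
f^-avoids-y·core23·2 zero    y∈ V pre suf eq
  with x , y32∈fLx ← F.factor-within-image V pre _ (D3 ∷ D2 ∷ []) suf ((λ ()) ∷ (λ ()) ∷ []) eq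
  = fL-avoids-y32 x y∈ y32∈fLx
f^-avoids-y·core23·2 (suc m) y∈ V pre suf eq
  with W₁ , z , W₃ , W≡ , y3-suffix , fW₃ ←
         F.desubstitute-around (f^ (suc m) V) pre _ (D3 ∷ []) (core23 m) ((λ ()) ∷ []) (F.marker _)
           (trans eq (cong (λ w → pre ++ _ ∷ w) (core23-suc m (D2 ∷ suf))))
  with W₃′ , refl ← f-starting-012032 W₃ suf fW₃
  = f^-avoids-y·core23·2 m (fL-ending-y3 z y∈ y3-suffix) V W₁ W₃′ W≡

g∘f^-avoids-T23 : ∀ n V P S → g (f^ (suc n) V) ≢ P ++ T23 n ++ S
g∘f^-avoids-T23 n V P S eq
  with W₁ , z , W₃ , W≡ , e-suffix , gW₃ ←
         G.desubstitute-around (f^ (suc n) V) P e [] (core23 n) [] (G.marker _)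
           (trans eq (cong (P ++_) (T23-unfold n S)))
  with W₃′ , refl ← g-starting-abcdeacdb W₃ S gW₃
  = f^-avoids-y·core23·2 n (gL-ending-e z e-suffix) V W₁ W₃′ W≡

nth-++ˡ : ∀ (x₀ : X) u r {i} → i < length u → nth x₀ (u ++ r) i ≡ nth x₀ u i
nth-++ˡ x₀ (x ∷ u) r {zero}  _         = refl
nth-++ˡ x₀ (x ∷ u) r {suc i} (s≤s i<u) = nth-++ˡ x₀ u r i<u

prefix-from-nth : ∀ (x₀ : X) G u → length u ≤ length G →
  (∀ j → nth x₀ G (toℕ j) ≡ lookup u j) → ∃ λ S → G ≡ u ++ S
prefix-from-nth x₀ G       []      _         _  = G , refl
prefix-from-nth x₀ (y ∷ G) (x ∷ u) (s≤s u≤G) at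
  with refl ← at fzero
  with S , G≡ ← prefix-from-nth x₀ G u u≤G (λ j → at (fsuc j))
  = S , cong (y ∷_) G≡

factor-from-nth : ∀ (x₀ : X) G u i → i + length u ≤ length G →
  (∀ j → nth x₀ G (i + toℕ j) ≡ lookup u j) → ∃₂ λ P S → G ≡ P ++ u ++ S
factor-from-nth x₀ G       u zero    fits at with S , G≡ ← prefix-from-nth x₀ G u fits at = [] , S , G≡
factor-from-nth x₀ (y ∷ G) u (suc i) (s≤s fits) at
  with P , S , G≡ ← factor-from-nth x₀ G u i fits at
  = y ∷ P , S , cong (y ∷_) G≡

w5-from-iterate : ∀ {k N} → k < N → nth a (g (f^ N (D0 ∷ []))) k ≡ w5 k
w5-from-iterate {k} {N} k<N with r , eq ← f^-prefix k<N = begin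
  nth a (g (f^ N (D0 ∷ []))) k                   ≡⟨ cong (λ w → nth a (g w) k) eq ⟩
  nth a (g (Fk ++ r)) k                          ≡⟨ cong (λ w → nth a w k) (concatMap-++ gL Fk r) ⟩
  nth a (g Fk ++ g r) k                          ≡⟨ nth-++ˡ a (g Fk) (g r) k<|gFk| ⟩
  nth a (g Fk) k                                 ∎
  where
  open ≡-Reasoning
  Fk : List D
  Fk = f^ (suc k) (D0 ∷ [])
  k<|gFk| : k < length (g Fk)
  k<|gFk| = <-trans (n<1+n k) (<-≤-trans (length-f^ (suc k)) (length-g Fk))

factor-of-w5-in-iterates : ∀ {u} → IsFactorOf u w5 → ∃ λ V → ∀ M → ∃₂ λ P S → g (f^ M V) ≡ P ++ u ++ S
factor-of-w5-in-iterates {u} (i , occurs) = f^ K (D0 ∷ []) , in-iterate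
  where
  K : ℕ
  K = i + length u
  in-iterate : ∀ M → ∃₂ λ P S → g (f^ M (f^ K (D0 ∷ []))) ≡ P ++ u ++ S
  in-iterate M = subst (λ w → ∃₂ λ P S → g w ≡ P ++ u ++ S) (f^-+ M K _)
      (factor-from-nth a _ u i fits occurs-in-prefix)
    where
    K≤M+K : K ≤ M + K
    K≤M+K = m≤n+m K M
    fits : K ≤ length (g (f^ (M + K) (D0 ∷ [])))
    fits = ≤-trans K≤M+K (<⇒≤ (<-≤-trans (length-f^ (M + K)) (length-g (f^ (M + K) (D0 ∷ [])))))
    occurs-in-prefix : ∀ j → nth a (g (f^ (M + K) (D0 ∷ []))) (i + toℕ j) ≡ lookup u j
    occurs-in-prefix j = trans (w5-from-iterate (<-≤-trans (+-monoʳ-< i (Fin.toℕ<n j)) K≤M+K)) (occurs j)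

mainTheorem3 : (n : ℕ) →
    IsConjugateOf (T23 n) (g (f^ n (D2 ∷ D3 ∷ []))) × ¬ IsFactorOf (T23 n) w5
mainTheorem3 n = T23-conjugate n , T23-not-factor
  where
  T23-not-factor : ¬ IsFactorOf (T23 n) w5
  T23-not-factor occurs
    with V , in-iterates ← factor-of-w5-in-iterates occurs
    with P , S , eq ← in-iterates (suc n)
    = g∘f^-avoids-T23 n V P S eq
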